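{- Let $\mathbf{SUB}\in\{\mathbf{NFL},\mathbf{FL},\mathbf{BCI},\mathbf{BCK},\mathbf{BCW}\}$ and let $\mathcal L$ be its Lindenbaum–Tarski algebra. Then the canonical frame $(X,\perp,Y,R)$ of $\mathbf{SUB}$ belongs to the frame class $\mathbb{SUB}$.
   Context: Logics. Language: $\varphi::=p_i\mid\top\mid\bot\mid\varphi\wedge\varphi\mid\varphi\vee\varphi\mid\varphi\circ\varphi\mid\varphi\to\varphi\mid\varphi\leftarrow\varphi$. An NFL-algebra is a bounded lattice $(L,\wedge,\vee,0,1)$ with binary operations $\circ,\to,\leftarrow$ such that $a\circ b\le c$ iff $b\le a\to c$ iff $a\le c\leftarrow b$; FL-algebra: plus $\circ$ associative; BCI-algebra: FL-algebra with $\circ$ commutative; BCK-algebra: BCI-algebra with $b\circ a\le a$; BCW-algebra: BCI-algebra with $a\wedge b\le a\circ b$. $\varphi\vdash\psi$ is derivable in $\mathbf{SUB}$ iff $v(\varphi)\le v(\psi)$ for every SUB-algebra and valuation $v$. The Lindenbaum–Tarski algebra $\mathcal L$ is the set of formulas modulo mutual derivability, with the induced operations. Canonical frame: $X$ is the set of proper lattice filters of $\mathcal L$, $Y$ the set of proper lattice ideals, $x\perp y$ iff $x\cap y\neq\emptyset$, and $xRzz'$ iff for all $a\in z$ and $b\in z'$, $a\circ b\in x$. Frames and classes. For a frame $(X,\perp,Y,R)$ with $R\subseteq X^3$, let $I=(X\times Y)\setminus\perp$; a frame is required to satisfy: every $x$ has some $y$ with $xIy$ and every $y$ has some $x$ with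 $xIy$. $U^\perp=\{y:\forall x\in U\,(x\perp y)\}$; preorder $x\preceq z$ iff $\{x\}^\perp\subseteq\{z\}^\perp$. Constraints: (C1) for all $w,z,u,v\in X$: $\exists x(xRuv\wedge zRxw)$ iff $\exists x(xRvw\wedge zRux)$; (C2) $xRzz'$ iff $xRz'z$; (C3) $xRzz'$ implies $z'\preceq x$; (C4) $xRxx$. Classes: $\mathbb{NFL}$ all frames; $\mathbb{FL}$: (C1); $\mathbb{BCI}$: (C1),(C2); $\mathbb{BCK}$: (C1),(C2),(C3); $\mathbb{BCW}$: (C1),(C2),(C4). -}

module Defs where

open import Level using (Level; _⊔_; 0ℓ) renaming (suc to lsuc)
open import Data.Nat using (ℕ)
open import Data.Product using (Σ; ∃; ∃-syntax; _×_; _,_)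
open import Relation.Nullary using (¬_)
open import Data.Unit using (⊤)
open import Relation.Binary.Lattice.Bundles using (BoundedLattice)

infixr 7 _∧f_
infixr 6 _∨f_
infixr 8 _∘f_
infixr 5 _⇒f_
infixl 5 _⇐f_

data Formula : Set where
  var   : ℕ → Formula
  ⊤f ⊥f : Formula
  _∧f_ _∨f_ _∘f_ _⇒f_ _⇐f_ : Formula → Formula → Formula

record NFLAlgebra : Set₁ where
  field
    boundedLattice : BoundedLattice 0ℓ 0ℓ 0ℓ
  open BoundedLattice boundedLattice public
  field
    _∘_ _⇒_ _⇐_ : Carrier → Carrier → Carrier
    res₁ : ∀ a b c → (a ∘ b) ≤ c → b ≤ (a ⇒ c)
    res₂ : ∀ a b c → b ≤ (a ⇒ c) → (a ∘ b) ≤ c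
    res₃ : ∀ a b c → (a ∘ b) ≤ c → a ≤ (c ⇐ b)
    res₄ : ∀ a b c → a ≤ (c ⇐ b) → (a ∘ b) ≤ c

data Sys : Set where
  NFL FL BCI BCK BCW : Sys

module _ (A : NFLAlgebra) where
  open NFLAlgebra A

  IsAssoc : Set
  IsAssoc = ∀ a b c → ((a ∘ b) ∘ c) ≈ (a ∘ (b ∘ c))

  IsComm : Set
  IsComm = ∀ a b → (a ∘ b) ≈ (b ∘ a)

  IsK : Set
  IsK = ∀ a b → (b ∘ a) ≤ a

  IsW : Set
  IsW = ∀ a b → (a ∧ b) ≤ (a ∘ b)

IsSubAlg : Sys → NFLAlgebra → Set
IsSubAlg NFL A = ⊤
IsSubAlg FL  A = IsAssoc A
IsSubAlg BCI A = IsAssoc A × IsComm A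
IsSubAlg BCK A = (IsAssoc A × IsComm A) × IsK A
IsSubAlg BCW A = (IsAssoc A × IsComm A) × IsW A

⟦_⟧ : Formula → (A : NFLAlgebra) → (ℕ → NFLAlgebra.Carrier A) → NFLAlgebra.Carrier A
⟦ var i ⟧   A v = v i
⟦ ⊤f ⟧      A v = NFLAlgebra.⊤ A
⟦ ⊥f ⟧      A v = NFLAlgebra.⊥ A
⟦ φ ∧f ψ ⟧  A v = NFLAlgebra._∧_ A (⟦ φ ⟧ A v) (⟦ ψ ⟧ A v)
⟦ φ ∨f ψ ⟧  A v = NFLAlgebra._∨_ A (⟦ φ ⟧ A v) (⟦ ψ ⟧ A v)
⟦ φ ∘f ψ ⟧  A v = NFLAlgebra._∘_ A (⟦ φ ⟧ A v) (⟦ ψ ⟧ A v)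
⟦ φ ⇒f ψ ⟧  A v = NFLAlgebra._⇒_ A (⟦ φ ⟧ A v) (⟦ ψ ⟧ A v)
⟦ φ ⇐f ψ ⟧  A v = NFLAlgebra._⇐_ A (⟦ φ ⟧ A v) (⟦ ψ ⟧ A v)

_⊢[_]_ : Formula → Sys → Formula → Set₁
φ ⊢[ s ] ψ = (A : NFLAlgebra) → IsSubAlg s A → (v : ℕ → NFLAlgebra.Carrier A) →
             NFLAlgebra._≤_ A (⟦ φ ⟧ A v) (⟦ ψ ⟧ A v)

-- Lindenbaum–Tarski algebra: formulas modulo ⊣⊢.  A subset of it is
-- represented by a predicate on formulas; for filters/ideals, invariance
-- under ⊣⊢ follows from up/down-closure.

record ProperFilter (s : Sys) : Set₂ where
  field
    mem      : Formula → Set₁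
    nonempty : ∃[ a ] mem a
    upward   : ∀ {a b} → mem a → a ⊢[ s ] b → mem b
    meet     : ∀ {a b} → mem a → mem b → mem (a ∧f b)
    proper   : ¬ (∀ a → mem a)

record ProperIdeal (s : Sys) : Set₂ where
  field
    mem      : Formula → Set₁
    nonempty : ∃[ a ] mem a
    downward : ∀ {a b} → mem a → b ⊢[ s ] a → mem b
    join     : ∀ {a b} → mem a → mem b → mem (a ∨f b)
    proper   : ¬ (∀ a → mem a)

record Frame (a b ℓ : Level) : Set (lsuc (a ⊔ b ⊔ ℓ)) where
  field
    X   : Set a
    Y   : Set b
    _⊥_ : X → Y → Set ℓ
    R   : X → X → X → Set ℓ

module _ {a b ℓ} (F : Frame a b ℓ) where
  open Frame F

  I : X → Y → Set ℓ
  I x y = ¬ (x ⊥ y)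

  IsFrame : Set (a ⊔ b ⊔ ℓ)
  IsFrame = (∀ x → ∃[ y ] I x y) × (∀ y → ∃[ x ] I x y)

  _⪯_ : X → X → Set (b ⊔ ℓ)
  x ⪯ z = ∀ y → x ⊥ y → z ⊥ y

  C1 : Set (a ⊔ ℓ)
  C1 = ∀ w z u v →
         ((∃[ x ] (R x u v × R z x w)) → (∃[ x ] (R x v w × R z u x))) ×
         ((∃[ x ] (R x v w × R z u x)) → (∃[ x ] (R x u v × R z x w)))

  C2 : Set (a ⊔ ℓ)
  C2 = ∀ x z z' → (R x z z' → R x z' z) × (R x z' z → R x z z')

  C3 : Set (a ⊔ b ⊔ ℓ)
  C3 = ∀ x z z' → R x z z' → z' ⪯ x

  C4 : Set (a ⊔ ℓ)
  C4 = ∀ x → R x x x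

InClass : ∀ {a b ℓ} → Sys → Frame a b ℓ → Set (a ⊔ b ⊔ ℓ)
InClass NFL F = IsFrame F
InClass FL  F = IsFrame F × C1 F
InClass BCI F = IsFrame F × C1 F × C2 F
InClass BCK F = IsFrame F × C1 F × C2 F × C3 F
InClass BCW F = IsFrame F × C1 F × C2 F × C4 F

canonicalFrame : (s : Sys) → Frame (lsuc (lsuc 0ℓ)) (lsuc (lsuc 0ℓ)) (lsuc 0ℓ)
canonicalFrame s = record
  { X   = ProperFilter s
  ; Y   = ProperIdeal s
  ; _⊥_ = λ x y → ∃[ a ] (ProperFilter.mem x a × ProperIdeal.mem y a)
  ; R   = λ x z z' → ∀ a b → ProperFilter.mem z a → ProperFilter.mem z' b →
                     ProperFilter.mem x (a ∘f b)
  }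

-- Each frame condition is the canonical image of the matching algebraic law:
-- commutativity gives (C2), b ∘ a ≤ a gives (C3), a ∧ b ≤ a ∘ b gives (C4).
-- For (C1), given x with x R u v and z R x w, the filter generated by the
-- products b ∘ c (b ∈ v, c ∈ w) witnesses the right-hand side: associativity
-- puts every a ∘ (b ∘ c) with a ∈ u into z, which also makes that filter proper,
-- since b ∘ c ⊢ ⊥ would force ⊥ ∈ z. The frame axioms use the filter of theorems
-- and the ideal of refutable formulas, proper because the two-element Boolean
-- algebra, which lies in every class, refutes ⊤ ⊢ ⊥.
module Submission where

open import Defs
open import Level using (0ℓ) renaming (suc to lsuc)
open import Data.Bool using (Bool; true; false; not) renaming (_∧_ to _&&_; _∨_ to _||_)
open import Data.Bool.Properties using (∨-∧-lattice; ∧-identityʳ; ∧-idem; ∧-assoc; ∧-comm)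
open import Data.Product using (∃-syntax; _×_; _,_; proj₁; proj₂)
open import Data.Unit using (tt)
open import Function using (_∘′_)
open import Relation.Binary.Bundles using (Preorder)
open import Relation.Binary.Lattice.Bundles using (BoundedLattice)
open import Relation.Binary.PropositionalEquality using (_≡_; refl; sym; isEquivalence)
open import Relation.Nullary using (¬_)
import Algebra.Lattice.Properties.Lattice as LatticeProperties
import Relation.Binary.Reasoning.Preorder as PreorderReasoning

module NFLAlgebraProperties (A : NFLAlgebra) where
  open NFLAlgebra A renaming (refl to ≤-refl)

  ∘-monoˡ : ∀ {a a'} b → a ≤ a' → a ∘ b ≤ a' ∘ b
  ∘-monoˡ {a} {a'} b a≤a' = res₄ a b (a' ∘ b) (trans a≤a' (res₃ a' b (a' ∘ b) ≤-refl))

  ∘-monoʳ : ∀ a {b b'} → b ≤ b' → a ∘ b ≤ a ∘ b'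
  ∘-monoʳ a {b} {b'} b≤b' = res₂ a b (a ∘ b') (trans b≤b' (res₁ a b' (a ∘ b') ≤-refl))

  ∘-mono : ∀ {a a' b b'} → a ≤ a' → b ≤ b' → a ∘ b ≤ a' ∘ b'
  ∘-mono {a' = a'} {b = b} a≤a' b≤b' = trans (∘-monoˡ b a≤a') (∘-monoʳ a' b≤b')

  ∘-zeroˡ : ∀ a → ⊥ ∘ a ≤ ⊥
  ∘-zeroˡ a = res₄ ⊥ a ⊥ (minimum (⊥ ⇐ a))

  ∘-zeroʳ : ∀ a → a ∘ ⊥ ≤ ⊥
  ∘-zeroʳ a = res₂ a ⊥ ⊥ (minimum (a ⇒ ⊥))

boolBoundedLattice : BoundedLattice 0ℓ 0ℓ 0ℓ
boolBoundedLattice = record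
  { Carrier          = Bool
  ; _≈_              = _≡_
  ; _≤_              = λ a b → a ≡ a && b
  ; _∨_              = _||_
  ; _∧_              = _&&_
  ; ⊤                = true
  ; ⊥                = false
  ; isBoundedLattice = record
    { isLattice = ∨-∧-isOrderTheoreticLattice
    ; maximum   = λ a → sym (∧-identityʳ a)
    ; minimum   = λ _ → refl
    }
  }
  where open LatticeProperties ∨-∧-lattice using (∨-∧-isOrderTheoreticLattice)

boolNFLAlgebra : NFLAlgebra
boolNFLAlgebra = record
  { boundedLattice = boolBoundedLattice
  ; _∘_  = _&&_
  ; _⇒_  = λ a c → not a || c
  ; _⇐_  = λ c b → not b || c
  ; res₁ = res₁
  ; res₂ = res₂
  ; res₃ = res₃
  ; res₄ = res₄
  }
  where
  res₁ : ∀ a b c → a && b ≡ (a && b) && c → b ≡ b && (not a || c)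
  res₁ false b c _ = sym (∧-identityʳ b)
  res₁ true  b c p = p

  res₂ : ∀ a b c → b ≡ b && (not a || c) → a && b ≡ (a && b) && c
  res₂ false b c _ = refl
  res₂ true  b c p = p

  res₃ : ∀ a b c → a && b ≡ (a && b) && c → a ≡ a && (not b || c)
  res₃ false b     c _ = refl
  res₃ true  false c _ = refl
  res₃ true  true  c p = p

  res₄ : ∀ a b c → a ≡ a && (not b || c) → a && b ≡ (a && b) && c
  res₄ false b     c _ = refl
  res₄ true  false c _ = refl
  res₄ true  true  c p = p

boolNFLAlgebra-isSubAlg : ∀ s → IsSubAlg s boolNFLAlgebra
boolNFLAlgebra-isSubAlg NFL = tt
boolNFLAlgebra-isSubAlg FL  = ∧-assoc
boolNFLAlgebra-isSubAlg BCI = ∧-assoc , ∧-comm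
boolNFLAlgebra-isSubAlg BCK = (∧-assoc , ∧-comm) , k
  where
  k : IsK boolNFLAlgebra
  k a false = refl
  k a true  = sym (∧-idem a)
boolNFLAlgebra-isSubAlg BCW = (∧-assoc , ∧-comm) , λ a b → NFLAlgebra.refl boolNFLAlgebra

⊤f⊬⊥f : ∀ s → ¬ (⊤f ⊢[ s ] ⊥f)
⊤f⊬⊥f s ⊤⊢⊥ with ⊤⊢⊥ boolNFLAlgebra (boolNFLAlgebra-isSubAlg s) (λ _ → false)
... | ()

⊢-preorder : Sys → Preorder 0ℓ 0ℓ (lsuc 0ℓ)
⊢-preorder s = record
  { Carrier    = Formula
  ; _≈_        = _≡_
  ; _≲_        = λ φ ψ → φ ⊢[ s ] ψ
  ; isPreorder = record
    { isEquivalence = isEquivalence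
    ; reflexive     = λ { refl A _ _ → NFLAlgebra.refl A }
    ; trans         = λ φ⊢ψ ψ⊢χ A h v → NFLAlgebra.trans A (φ⊢ψ A h v) (ψ⊢χ A h v)
    }
  }

-- ⟦_⟧ is not injective, so the formulas of a derivation are never inferred:
-- lemmas take them explicitly and chains display them.
module Derivability (s : Sys) where
  open PreorderReasoning (⊢-preorder s) public

  ⊢-refl : ∀ φ → φ ⊢[ s ] φ
  ⊢-refl φ A _ _ = NFLAlgebra.refl A

  ⊥f-least : ∀ φ → ⊥f ⊢[ s ] φ
  ⊥f-least φ A _ _ = NFLAlgebra.minimum A _

  ⊤f-greatest : ∀ φ → φ ⊢[ s ] ⊤f
  ⊤f-greatest φ A _ _ = NFLAlgebra.maximum A _

  ∨f-least : ∀ φ ψ χ → φ ⊢[ s ] χ → ψ ⊢[ s ] χ → (φ ∨f ψ) ⊢[ s ] χ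
  ∨f-least φ ψ χ φ⊢χ ψ⊢χ A h v = NFLAlgebra.∨-least A (φ⊢χ A h v) (ψ⊢χ A h v)

  ∧f-greatest : ∀ φ ψ χ → φ ⊢[ s ] ψ → φ ⊢[ s ] χ → φ ⊢[ s ] (ψ ∧f χ)
  ∧f-greatest φ ψ χ φ⊢ψ φ⊢χ A h v = NFLAlgebra.∧-greatest A (φ⊢ψ A h v) (φ⊢χ A h v)

  ∧f-mono : ∀ φ φ' ψ ψ' → φ ⊢[ s ] φ' → ψ ⊢[ s ] ψ' → (φ ∧f ψ) ⊢[ s ] (φ' ∧f ψ')
  ∧f-mono φ φ' ψ ψ' φ⊢φ' ψ⊢ψ' A h v =
    ∧-greatest (trans (x∧y≤x _ _) (φ⊢φ' A h v)) (trans (x∧y≤y _ _) (ψ⊢ψ' A h v))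
    where open NFLAlgebra A

  ∘f-monoʳ : ∀ a b b' → b ⊢[ s ] b' → (a ∘f b) ⊢[ s ] (a ∘f b')
  ∘f-monoʳ a b b' b⊢b' A h v = NFLAlgebraProperties.∘-monoʳ A _ (b⊢b' A h v)

  ∘f-monoˡ : ∀ a a' b → a ⊢[ s ] a' → (a ∘f b) ⊢[ s ] (a' ∘f b)
  ∘f-monoˡ a a' b a⊢a' A h v = NFLAlgebraProperties.∘-monoˡ A _ (a⊢a' A h v)

  ∘f-zeroˡ : ∀ a → (⊥f ∘f a) ⊢[ s ] ⊥f
  ∘f-zeroˡ a A _ _ = NFLAlgebraProperties.∘-zeroˡ A _

  ∘f-zeroʳ : ∀ a → (a ∘f ⊥f) ⊢[ s ] ⊥f
  ∘f-zeroʳ a A _ _ = NFLAlgebraProperties.∘-zeroʳ A _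

  ∘f-subdistrib-∧f : ∀ a a' b b' → ((a ∧f a') ∘f (b ∧f b')) ⊢[ s ] ((a ∘f b) ∧f (a' ∘f b'))
  ∘f-subdistrib-∧f a a' b b' A _ _ =
    ∧-greatest (∘-mono (x∧y≤x _ _) (x∧y≤x _ _)) (∘-mono (x∧y≤y _ _) (x∧y≤y _ _))
    where
    open NFLAlgebra A
    open NFLAlgebraProperties A

  module _ (assoc : ∀ A → IsSubAlg s A → IsAssoc A) where
    ∘f-assocˡ : ∀ a b c → ((a ∘f b) ∘f c) ⊢[ s ] (a ∘f (b ∘f c))
    ∘f-assocˡ a b c A h _ = NFLAlgebra.reflexive A (assoc A h _ _ _)

    ∘f-assocʳ : ∀ a b c → (a ∘f (b ∘f c)) ⊢[ s ] ((a ∘f b) ∘f c)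
    ∘f-assocʳ a b c A h _ = NFLAlgebra.reflexive A (NFLAlgebra.Eq.sym A (assoc A h _ _ _))

  ∘f-comm : (∀ A → IsSubAlg s A → IsComm A) → ∀ a b → (a ∘f b) ⊢[ s ] (b ∘f a)
  ∘f-comm comm a b A h _ = NFLAlgebra.reflexive A (comm A h _ _)

  ∘f-decreasing : (∀ A → IsSubAlg s A → IsK A) → ∀ a b → (b ∘f a) ⊢[ s ] a
  ∘f-decreasing k a b A h _ = k A h _ _

  ∧f⊢∘f : (∀ A → IsSubAlg s A → IsW A) → ∀ a b → (a ∧f b) ⊢[ s ] (a ∘f b)
  ∧f⊢∘f w a b A h _ = w A h _ _

module CanonicalFrame (s : Sys) where
  open Derivability s
  open Frame (canonicalFrame s)
  private
    module Fil = ProperFilter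
    module Idl = ProperIdeal

  ⊥f∉filter : (x : X) → ¬ Fil.mem x ⊥f
  ⊥f∉filter x ⊥f∈x = Fil.proper x (λ φ → Fil.upward x ⊥f∈x (⊥f-least φ))

  ⊤f∉ideal : (y : Y) → ¬ Idl.mem y ⊤f
  ⊤f∉ideal y ⊤f∈y = Idl.proper y (λ φ → Idl.downward y ⊤f∈y (⊤f-greatest φ))

  ⊥f-ideal : Y
  ⊥f-ideal = record
    { mem      = λ φ → φ ⊢[ s ] ⊥f
    ; nonempty = ⊥f , ⊢-refl ⊥f
    ; downward = λ {φ} {ψ} φ⊢⊥ ψ⊢φ → begin ψ ≲⟨ ψ⊢φ ⟩ φ ≲⟨ φ⊢⊥ ⟩ ⊥f ∎
    ; join     = λ {φ} {ψ} → ∨f-least φ ψ ⊥f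
    ; proper   = λ all⊢⊥ → ⊤f⊬⊥f s (all⊢⊥ ⊤f)
    }

  ⊤f-filter : X
  ⊤f-filter = record
    { mem      = λ φ → ⊤f ⊢[ s ] φ
    ; nonempty = ⊤f , ⊢-refl ⊤f
    ; upward   = λ {φ} {ψ} ⊤⊢φ φ⊢ψ → begin ⊤f ≲⟨ ⊤⊢φ ⟩ φ ≲⟨ φ⊢ψ ⟩ ψ ∎
    ; meet     = λ {φ} {ψ} → ∧f-greatest ⊤f φ ψ
    ; proper   = λ ⊤⊢all → ⊤f⊬⊥f s (⊤⊢all ⊥f)
    }

  isFrame : IsFrame (canonicalFrame s)
  isFrame = (λ x → ⊥f-ideal , λ { (φ , φ∈x , φ⊢⊥) → ⊥f∉filter x (Fil.upward x φ∈x φ⊢⊥) })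
          , (λ y → ⊤f-filter , λ { (φ , ⊤⊢φ , φ∈y) → ⊤f∉ideal y (Idl.downward y φ∈y ⊤⊢φ) })

  ∘-Consistent : X → X → Set₁
  ∘-Consistent v w = ∀ {b c} → Fil.mem v b → Fil.mem w c → ¬ ((b ∘f c) ⊢[ s ] ⊥f)

  ∘-filter : (v w : X) → ∘-Consistent v w → X
  ∘-filter v w consistent = record
    { mem      = mem
    ; nonempty = nonempty
    ; upward   = λ { {d} {d'} (b , c , b∈v , c∈w , bc⊢d) d⊢d' →
                     b , c , b∈v , c∈w , (begin b ∘f c ≲⟨ bc⊢d ⟩ d ≲⟨ d⊢d' ⟩ d' ∎) }
    ; meet     = λ { {d} {d'} (b , c , b∈v , c∈w , bc⊢d) (b' , c' , b'∈v , c'∈w , b'c'⊢d') →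
                     b ∧f b' , c ∧f c' , Fil.meet v b∈v b'∈v , Fil.meet w c∈w c'∈w ,
                     (begin
                       (b ∧f b') ∘f (c ∧f c')     ≲⟨ ∘f-subdistrib-∧f b b' c c' ⟩
                       (b ∘f c) ∧f (b' ∘f c')     ≲⟨ ∧f-mono (b ∘f c) d (b' ∘f c') d' bc⊢d b'c'⊢d' ⟩
                       d ∧f d'                    ∎) }
    ; proper   = λ all → let (b , c , b∈v , c∈w , bc⊢⊥) = all ⊥f in consistent b∈v c∈w bc⊢⊥
    }
    where
    mem : Formula → Set₁
    mem d = ∃[ b ] ∃[ c ] (Fil.mem v b × Fil.mem w c × (b ∘f c) ⊢[ s ] d)

    nonempty : ∃[ d ] mem d
    nonempty with Fil.nonempty v | Fil.nonempty w
    ... | b , b∈v | c , c∈w = b ∘f c , b , c , b∈v , c∈w , ⊢-refl (b ∘f c)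

  R-∘-filter : ∀ v w (consistent : ∘-Consistent v w) → R (∘-filter v w consistent) v w
  R-∘-filter v w _ b c b∈v c∈w = b , c , b∈v , c∈w , ⊢-refl (b ∘f c)

  R-factorʳ : ∀ z u v w →
              (∀ a b c → Fil.mem u a → Fil.mem v b → Fil.mem w c → Fil.mem z (a ∘f (b ∘f c))) →
              ∃[ x ] (R x v w × R z u x)
  R-factorʳ z u v w a[bc]∈z = ∘-filter v w consistent , R-∘-filter v w consistent , Rzux
    where
    ∈z : ∀ {a b c d} → Fil.mem u a → Fil.mem v b → Fil.mem w c → (b ∘f c) ⊢[ s ] d → Fil.mem z (a ∘f d)
    ∈z {a} {b} {c} {d} a∈u b∈v c∈w bc⊢d =
      Fil.upward z (a[bc]∈z a b c a∈u b∈v c∈w) (∘f-monoʳ a (b ∘f c) d bc⊢d)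

    consistent : ∘-Consistent v w
    consistent b∈v c∈w bc⊢⊥ with Fil.nonempty u
    ... | a , a∈u = ⊥f∉filter z (Fil.upward z (∈z {d = ⊥f} a∈u b∈v c∈w bc⊢⊥) (∘f-zeroʳ a))

    Rzux : R z u (∘-filter v w consistent)
    Rzux a d a∈u (b , c , b∈v , c∈w , bc⊢d) = ∈z a∈u b∈v c∈w bc⊢d

  R-factorˡ : ∀ z u v w →
              (∀ a b c → Fil.mem u a → Fil.mem v b → Fil.mem w c → Fil.mem z ((a ∘f b) ∘f c)) →
              ∃[ x ] (R x u v × R z x w)
  R-factorˡ z u v w [ab]c∈z = ∘-filter u v consistent , R-∘-filter u v consistent , Rzxw
    where
    ∈z : ∀ {a b c d} → Fil.mem u a → Fil.mem v b → Fil.mem w c → (a ∘f b) ⊢[ s ] d → Fil.mem z (d ∘f c)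
    ∈z {a} {b} {c} {d} a∈u b∈v c∈w ab⊢d =
      Fil.upward z ([ab]c∈z a b c a∈u b∈v c∈w) (∘f-monoˡ (a ∘f b) d c ab⊢d)

    consistent : ∘-Consistent u v
    consistent a∈u b∈v ab⊢⊥ with Fil.nonempty w
    ... | c , c∈w = ⊥f∉filter z (Fil.upward z (∈z {d = ⊥f} a∈u b∈v c∈w ab⊢⊥) (∘f-zeroˡ c))

    Rzxw : R z (∘-filter u v consistent) w
    Rzxw d c (a , b , a∈u , b∈v , ab⊢d) c∈w = ∈z a∈u b∈v c∈w ab⊢d

  C1-from-assoc : (∀ A → IsSubAlg s A → IsAssoc A) → C1 (canonicalFrame s)
  C1-from-assoc assoc w z u v =
      (λ { (x , Rxuv , Rzxw) → R-factorʳ z u v w λ a b c a∈u b∈v c∈w →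
             Fil.upward z (Rzxw (a ∘f b) c (Rxuv a b a∈u b∈v) c∈w) (∘f-assocˡ assoc a b c) })
    , (λ { (x , Rxvw , Rzux) → R-factorˡ z u v w λ a b c a∈u b∈v c∈w →
             Fil.upward z (Rzux a (b ∘f c) a∈u (Rxvw b c b∈v c∈w)) (∘f-assocʳ assoc a b c) })

  C2-from-comm : (∀ A → IsSubAlg s A → IsComm A) → C2 (canonicalFrame s)
  C2-from-comm comm x z z' = R-swap z z' , R-swap z' z
    where
    R-swap : ∀ z z' → R x z z' → R x z' z
    R-swap z z' Rxzz' a b a∈z' b∈z = Fil.upward x (Rxzz' b a b∈z a∈z') (∘f-comm comm b a)

  C3-from-K : (∀ A → IsSubAlg s A → IsK A) → C3 (canonicalFrame s)
  C3-from-K k x z z' Rxzz' y (a , a∈z' , a∈y) with Fil.nonempty z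
  ... | c , c∈z = c ∘f a , Rxzz' c a c∈z a∈z' , Idl.downward y a∈y (∘f-decreasing k a c)

  C4-from-W : (∀ A → IsSubAlg s A → IsW A) → C4 (canonicalFrame s)
  C4-from-W w x a b a∈x b∈x = Fil.upward x (Fil.meet x a∈x b∈x) (∧f⊢∘f w a b)

open CanonicalFrame

lemma4p3 : (s : Sys) → InClass s (canonicalFrame s)
lemma4p3 NFL = isFrame NFL
lemma4p3 FL  = isFrame FL , C1-from-assoc FL (λ _ assoc → assoc)
lemma4p3 BCI = isFrame BCI , C1-from-assoc BCI (λ _ → proj₁) , C2-from-comm BCI (λ _ → proj₂)
lemma4p3 BCK = isFrame BCK
             , C1-from-assoc BCK (λ _ → proj₁ ∘′ proj₁)
             , C2-from-comm BCK (λ _ → proj₂ ∘′ proj₁)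
             , C3-from-K BCK (λ _ → proj₂)
lemma4p3 BCW = isFrame BCW
             , C1-from-assoc BCW (λ _ → proj₁ ∘′ proj₁)
             , C2-from-comm BCW (λ _ → proj₂ ∘′ proj₁)
             , C4-from-W BCW (λ _ → proj₂)
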